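{- For all integers $n \geq 2$, \[ \mathrm{MOF}(K_n) \geq n - \frac{2n}{\log_2(n)}. \]
   Context: An orientation of a simple graph $G$ assigns to each edge $\{u,v\}$ exactly one of the arcs $(u,v)$ or $(v,u)$; if $(u,v)$ is an arc, $v$ is an out-neighbor of $u$. Oriented forcing: given an orientation $D$ and a set $S$ of initially colored vertices, any colored vertex having at most $1$ non-colored out-neighbor forces that out-neighbor to become colored; this rule is applied iteratively as long as possible. $S$ is a forcing set of $D$ if at the end every vertex is colored. $F(D)$ is the minimum size of a forcing set of $D$, and $\mathrm{MOF}(G)$ is the maximum of $F(D)$ over all orientations $D$ of $G$. $K_n$ is the complete graph on $n$ vertices. -}

module Defs where

open import Data.Nat using (ℕ)
open import Data.Bool using (Bool; true; false)
open import Data.Fin using (Fin)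
open import Data.Fin.Subset using (Subset; _∈_; ∣_∣)
open import Data.Product using (_×_)
open import Data.Sum using (_⊎_)
open import Relation.Nullary using (¬_)
open import Relation.Binary.PropositionalEquality using (_≡_; _≢_)

-- An orientation of the complete graph K_n on vertex set Fin n:
-- arc u v ≡ true means (u,v) is an arc (v is an out-neighbour of u).
record OrientationK (n : ℕ) : Set where
  field
    arc        : Fin n → Fin n → Bool
    irrefl     : ∀ u → arc u u ≡ false
    total      : ∀ u v → u ≢ v → arc u v ≡ true ⊎ arc v u ≡ true
    antisym    : ∀ u v → ¬ (arc u v ≡ true × arc v u ≡ true)
open OrientationK public

-- Vertices coloured at the end of the oriented forcing process started
-- from S: the least set containing S and closed under the forcing rule
-- (a coloured vertex u all of whose out-neighbours other than v are
-- coloured forces its out-neighbour v).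
data Colored {n : ℕ} (D : OrientationK n) (S : Subset n) : Fin n → Set where
  initial : ∀ {v} → v ∈ S → Colored D S v
  force   : ∀ {u v} → Colored D S u → arc D u v ≡ true →
            (∀ w → arc D u w ≡ true → w ≢ v → Colored D S w) →
            Colored D S v

IsForcingSet : ∀ {n} → OrientationK n → Subset n → Set
IsForcingSet {n} D S = ∀ (v : Fin n) → Colored D S v

AllForcingSetsSatisfy : ∀ {n} → OrientationK n → (ℕ → Set) → Set
AllForcingSetsSatisfy {n} D P = ∀ (S : Subset n) → IsForcingSet D S → P ∣ S ∣

{-# OPTIONS --safe #-}
-- Read in order, the n - |S| forcing steps of a forcing set S form a "run": the vertex forced at
-- step j was still uncoloured at every earlier step i, so it is not an out-neighbour of the
-- forcer u_i, i.e. it beats u_i.  It therefore suffices to build tournaments on n vertices all of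
-- whose runs force at most L vertices, with n ^ L ≤ 2 ^ (2n).
--
-- In a lexicographic product Q[B] the steps of a run group by the block of the forced vertex;
-- each group projects to a run of B, and the blocks of the groups form a run of Q for the
-- reflexive closure ≽ of the arcs.  So strict run bounds multiply with weak run bounds:
-- L(Q[B]) ≤ L≽(Q) · L(B).  The Paley tournaments on 11 and 19 vertices have few common
-- out-neighbours and few common dominators, which bounds their runs (checked by computation).
-- A transitive tournament of m copies of P19[...[P19[T2]]] (j factors P19) has about m·2·19^j
-- vertices and runs of at most m·8^j vertices, which is below 2n / log₂ n once j ≥ 3, i.e. for
-- n ≥ 2·19³; the smaller n are covered by a finite table of such products.
module Submission where

open import Data.Bool using (Bool; true; false; _∨_)
import Data.Bool.Properties as Bool
open import Data.Bool.ListAction using (any)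
open import Data.Fin using (Fin; _≟_; toℕ; inject≤)
import Data.Fin as Fin
open import Data.Fin.Properties using (any?; all?; ¬∀⟶∃¬; *↔×; inject≤-injective)
import Data.Fin.Properties as Finₚ
open import Data.Fin.Subset using (Subset; inside; outside; ⊤; ∣_∣; _∩_)
  renaming (_∈_ to _∈ₛ_; _∉_ to _∉ₛ_; _⊆_ to _⊆ₛ_)
open import Data.Fin.Subset.Properties using (∈⊤; ∣⊤∣≡n; x∈p∩q⁺; _∈?_; ∣p∣≤n; p⊆q⇒∣p∣≤∣q∣)
open import Data.List using (List; []; _∷_; length; map; reverse; filter; upTo; foldr; replicate)
open import Data.List.Membership.Propositional.Properties using (∈-map⁺)
open import Data.List.Properties using (length-map; length-reverse; unfold-reverse)
open import Data.List.Relation.Binary.Subset.Propositional using (_⊆_)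
open import Data.List.Relation.Binary.Subset.Propositional.Properties
  using (⊆-trans; ∈-∷⁺ʳ; filter-⊆) renaming (map⁺ to ⊆-map⁺)
open import Data.List.Relation.Unary.All as All using (All; []; _∷_)
import Data.List.Relation.Unary.All.Properties as Allₚ
open import Data.List.Relation.Unary.AllPairs as AllPairs using (AllPairs; []; _∷_)
import Data.List.Relation.Unary.AllPairs.Properties as AllPairsₚ
import Data.List.Relation.Unary.Any as Any
import Data.List.Relation.Unary.Any.Properties as Anyₚ
open import Data.List.Relation.Unary.Unique.Propositional using (Unique)
open import Data.Nat
  using (ℕ; zero; suc; _≤_; _<_; _^_; _*_; _∸_; _+_; z≤n; s≤s; _%_; _≡ᵇ_; NonZero; >-nonZero)
open import Data.Nat.DivMod using (_/_; m%n<n; m/n*n≤m; m≡m%n+[m/n]*n)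
open import Data.Nat.Induction using (<-wellFounded)
open import Data.Nat.Properties hiding (_≟_)
open import Algebra.Properties.CommutativeSemigroup *-commutativeSemigroup using (x∙yz≈y∙xz; xy∙z≈xz∙y)
open import Data.Nat.Tactic.RingSolver using (solve-∀)
open import Data.Product using (Σ; _×_; _,_; proj₁; proj₂)
import Data.Product as Product
open import Data.Sum using (_⊎_; inj₁; inj₂)
open import Data.Vec using (_∷_; _[_]≔_; here; there; tabulate)
open import Data.Vec.Properties using ([]≔-minimal; []≔-updates; lookup⇒[]=; lookup∘tabulate)
open import Function using (_∘_; _on_; flip)
open import Function.Bundles using (Inverse; Injection)
open import Function.Definitions using (Injective)
open import Function.Properties.Inverse using (↔⇒↣)
open import Induction.WellFounded using (Acc; acc)
open import Relation.Binary.Definitions using (DecidableEquality; tri<; tri≈; tri>)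
open import Relation.Binary.PropositionalEquality
  using (_≡_; _≢_; refl; sym; trans; cong; subst; ≢-sym)
open import Relation.Nullary using (¬_; contradiction; Dec; does; yes; no; ¬?; _×-dec_; _⊎-dec_; _→-dec_)
open import Relation.Nullary.Decidable using (decidable-stable; True; toWitness; dec-true; dec-false)
open import Relation.Unary using (Decidable; ∁)
open import Relation.Unary.Properties using (∁?)

open import Defs

-- Counting in finite sets and lists

suc∣p[x]≔outside∣≡∣p∣ : ∀ {n} {p : Subset n} {x} → x ∈ₛ p → suc ∣ p [ x ]≔ outside ∣ ≡ ∣ p ∣
suc∣p[x]≔outside∣≡∣p∣ {p = inside ∷ _}  here        = refl
suc∣p[x]≔outside∣≡∣p∣ {p = inside ∷ _}  (there x∈p) = cong suc (suc∣p[x]≔outside∣≡∣p∣ x∈p)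
suc∣p[x]≔outside∣≡∣p∣ {p = outside ∷ _} (there x∈p) = suc∣p[x]≔outside∣≡∣p∣ x∈p

∣p[x]≔inside∣≡suc∣p∣ : ∀ {n} {p : Subset n} {x} → x ∉ₛ p → ∣ p [ x ]≔ inside ∣ ≡ suc ∣ p ∣
∣p[x]≔inside∣≡suc∣p∣ {p = inside ∷ _}  {Fin.zero}  x∉p with () ← x∉p here
∣p[x]≔inside∣≡suc∣p∣ {p = outside ∷ _} {Fin.zero}  _   = refl
∣p[x]≔inside∣≡suc∣p∣ {p = inside ∷ _}  {Fin.suc _} x∉p = cong suc (∣p[x]≔inside∣≡suc∣p∣ (x∉p ∘ there))
∣p[x]≔inside∣≡suc∣p∣ {p = outside ∷ _} {Fin.suc _} x∉p = ∣p[x]≔inside∣≡suc∣p∣ (x∉p ∘ there)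

y∈p⇒y∈p[x]≔inside : ∀ {n} {p : Subset n} {y} x → y ∈ₛ p → y ∈ₛ p [ x ]≔ inside
y∈p⇒y∈p[x]≔inside {p = p} {y} x y∈p with y ≟ x
... | yes refl = []≔-updates p x
... | no y≢x   = []≔-minimal p y x y≢x y∈p

unique⇒length≤∣p∣ : ∀ {n} {p : Subset n} {xs} → Unique xs → All (_∈ₛ p) xs → length xs ≤ ∣ p ∣
unique⇒length≤∣p∣ [] [] = z≤n
unique⇒length≤∣p∣ {p = p} {x ∷ xs} (x∉xs ∷ xs!) (x∈p ∷ xs⊆p) =
  subst (suc (length xs) ≤_) (suc∣p[x]≔outside∣≡∣p∣ x∈p)
    (s≤s (unique⇒length≤∣p∣ xs! (All.zipWith stays (x∉xs , xs⊆p))))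
  where
  stays : ∀ {y} → x ≢ y × y ∈ₛ p → y ∈ₛ p [ x ]≔ outside
  stays (x≢y , y∈p) = []≔-minimal p _ x (≢-sym x≢y) y∈p

unique⇒length≤n : ∀ {n} {xs : List (Fin n)} → Unique xs → length xs ≤ n
unique⇒length≤n {n} {xs} xs! =
  subst (length xs ≤_) (∣⊤∣≡n n) (unique⇒length≤∣p∣ xs! (All.universal (λ _ → ∈⊤) _))

length-filter-∁ : ∀ {A : Set} {P : A → Set} (P? : Decidable P) xs →
                  length xs ≡ length (filter P? xs) + length (filter (∁? P?) xs)
length-filter-∁ P? [] = refl
length-filter-∁ P? (x ∷ xs) with does (P? x)
... | true  = cong suc (length-filter-∁ P? xs)
... | false = trans (cong suc (length-filter-∁ P? xs)) (sym (+-suc _ _))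

All-reverse⁺ : ∀ {A : Set} {P : A → Set} {xs} → All P xs → All P (reverse xs)
All-reverse⁺ = Allₚ.anti-mono Anyₚ.reverse⁻

AllPairs-reverse⁺ : ∀ {A : Set} {R : A → A → Set} {xs} → AllPairs R xs → AllPairs (flip R) (reverse xs)
AllPairs-reverse⁺ [] = []
AllPairs-reverse⁺ {R = R} {x ∷ xs} (Rx ∷ Rxs) =
  subst (AllPairs (flip R)) (sym (unfold-reverse x xs))
    (AllPairsₚ.++⁺ (AllPairs-reverse⁺ Rxs) ([] ∷ []) (All.map (_∷ []) (All-reverse⁺ Rx)))

-- Tournaments

record Tournament (V : Set) : Set where
  field
    arc     : V → V → Bool
    irrefl  : ∀ u → arc u u ≡ false
    total   : ∀ u v → u ≢ v → arc u v ≡ true ⊎ arc v u ≡ true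
    antisym : ∀ u v → ¬ (arc u v ≡ true × arc v u ≡ true)

orientation : ∀ {n} → Tournament (Fin n) → OrientationK n
orientation T = record
  { arc = Tournament.arc T ; irrefl = Tournament.irrefl T
  ; total = Tournament.total T ; antisym = Tournament.antisym T }

module _ {V : Set} where

  infix 4 _⟶[_]_ _≽[_]_

  _⟶[_]_ : V → Tournament V → V → Set
  x ⟶[ T ] y = Tournament.arc T x y ≡ true

  _≽[_]_ : V → Tournament V → V → Set
  x ≽[ T ] y = x ≡ y ⊎ x ⟶[ T ] y

  module _ (T : Tournament V) where

    ⟶⇒≢ : ∀ {x y} → x ⟶[ T ] y → x ≢ y
    ⟶⇒≢ {x} x⟶x refl with () ← trans (sym x⟶x) (Tournament.irrefl T x)

    ⟶-asym : ∀ {x y} → x ⟶[ T ] y → ¬ (y ⟶[ T ] x)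
    ⟶-asym x⟶y y⟶x = Tournament.antisym T _ _ (x⟶y , y⟶x)

    ≽-antisym : ∀ {x y} → x ≽[ T ] y → y ≽[ T ] x → x ≡ y
    ≽-antisym (inj₁ x≡y) _          = x≡y
    ≽-antisym (inj₂ _)   (inj₁ y≡x) = sym y≡x
    ≽-antisym (inj₂ x⟶y) (inj₂ y⟶x) with () ← ⟶-asym x⟶y y⟶x

pullback : {V W : Set} (f : W → V) → Injective _≡_ _≡_ f → Tournament V → Tournament W
pullback f f-inj T = record
  { arc     = Tournament.arc T on f
  ; irrefl  = Tournament.irrefl T ∘ f
  ; total   = λ u v u≢v → Tournament.total T (f u) (f v) (u≢v ∘ f-inj)
  ; antisym = λ u v → Tournament.antisym T (f u) (f v)
  }

transitive : ∀ m → Tournament (Fin m)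
transitive m = record
  { arc     = λ i j → does (i Finₚ.<? j)
  ; irrefl  = λ i → dec-false (i Finₚ.<? i) (Finₚ.<-irrefl refl)
  ; total   = connex
  ; antisym = λ i j (i<j , j<i) → Finₚ.<-asym (does⇒< i j i<j) (does⇒< j i j<i)
  }
  where
  does⇒< : ∀ i j → does (i Finₚ.<? j) ≡ true → i Fin.< j
  does⇒< i j holds = decidable-stable (i Finₚ.<? j) λ i≮j →
    contradiction (trans (sym holds) (dec-false (i Finₚ.<? j) i≮j)) λ ()

  connex : ∀ i j → i ≢ j → does (i Finₚ.<? j) ≡ true ⊎ does (j Finₚ.<? i) ≡ true
  connex i j i≢j with Finₚ.<-cmp i j
  ... | tri< i<j _ _ = inj₁ (dec-true (i Finₚ.<? j) i<j)
  ... | tri≈ _ i≡j _ with () ← i≢j i≡j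
  ... | tri> _ _ j<i = inj₂ (dec-true (j Finₚ.<? i) j<i)

decidedTournament : ∀ {n} (arc : Fin n → Fin n → Bool) →
  {True (all? λ u → arc u u Bool.≟ false)} →
  {True (all? λ u → all? λ v → ¬? (u ≟ v) →-dec (arc u v Bool.≟ true ⊎-dec arc v u Bool.≟ true))} →
  {True (all? λ u → all? λ v → ¬? (arc u v Bool.≟ true ×-dec arc v u Bool.≟ true))} →
  Tournament (Fin n)
decidedTournament arc {irrefl} {total} {antisym} = record
  { arc = arc ; irrefl = toWitness irrefl
  ; total = λ u v → toWitness total u v ; antisym = λ u v → toWitness antisym u v }

-- Runs

-- A step (v , u) records that u forced v, and a chain lists steps latest first.  After R z q says that z was still
-- uncoloured at step q; for a tournament, R z u is then the arc z ⟶ u.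
module _ {V : Set} (R : V → V → Set) where

  Forces : V × V → Set
  Forces q = R (proj₂ q) (proj₁ q)

  After : V → V × V → Set
  After z q = z ≢ proj₁ q × R z (proj₂ q)

  Chain : List (V × V) → Set
  Chain t = All Forces t × AllPairs (After ∘ proj₁) t

  Run : V → List (V × V) → Set
  Run z t = Chain t × All (After z) t

  RunsBoundedBy : ℕ → Set
  RunsBoundedBy L = ∀ {z t} → Run z t → suc (length t) ≤ L

module _ {V : Set} {R : V → V → Set} where

  chain-filter : ∀ {P : V × V → Set} (P? : Decidable P) {t} → Chain R t → Chain R (filter P? t)
  chain-filter P? (forces , afters) = Allₚ.filter⁺ P? forces , AllPairsₚ.filter⁺ P? afters

  chain-head : ∀ {q t} → Chain R (q ∷ t) → Forces R q × Run R (proj₁ q) t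
  chain-head (f ∷ fs , a ∷ as) = f , (fs , as) , a

  run-unique : ∀ {z t} → Run R z t → Unique (z ∷ map proj₁ t)
  run-unique ((_ , as) , zs) = Allₚ.map⁺ (All.map proj₁ zs) ∷ AllPairsₚ.map⁺ (AllPairs.map proj₁ as)

  chain-length≤ : ∀ {L t} → RunsBoundedBy R L → Chain R t → length t ≤ L
  chain-length≤ {t = []}    _       _     = z≤n
  chain-length≤ {t = _ ∷ _} bounded chain = bounded (proj₂ (chain-head chain))

module _ {V W : Set} {f : W → V} (f-inj : Injective _≡_ _≡_ f) {R : V → V → Set} where

  run-map : ∀ {z t} → Run (R on f) z t → Run R (f z) (map (Product.map f f) t)
  run-map ((forces , afters) , zs) =
    (Allₚ.map⁺ forces , AllPairsₚ.map⁺ (AllPairs.map after afters)) , Allₚ.map⁺ (All.map after zs)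
    where
    after : ∀ {z q} → After (R on f) z q → After R (f z) (Product.map f f q)
    after (z≢v , z⟶u) = z≢v ∘ f-inj , z⟶u

  runs-bounded-on : ∀ {L} → RunsBoundedBy R L → RunsBoundedBy (R on f) L
  runs-bounded-on bounded {t = t} run =
    subst (λ k → suc k ≤ _) (length-map _ t) (bounded (run-map run))

fin-runs-bounded : ∀ {n} {R : Fin n → Fin n → Set} → RunsBoundedBy R n
fin-runs-bounded {n} {t = t} run =
  subst (_≤ n) (cong suc (length-map proj₁ t)) (unique⇒length≤n (run-unique run))

fin2-strict-runs-bounded : (T : Tournament (Fin 2)) → RunsBoundedBy (_⟶[ T ]_) 1
fin2-strict-runs-bounded T {t = []} _ = s≤s z≤n
fin2-strict-runs-bounded T {z} {(v , u) ∷ _} ((u⟶v ∷ _ , _) , (z≢v , z⟶u) ∷ _)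
  with s≤s (s≤s ()) ← unique⇒length≤n {xs = z ∷ u ∷ v ∷ []}
                        ((⟶⇒≢ T z⟶u ∷ z≢v ∷ []) ∷ (⟶⇒≢ T u⟶v ∷ []) ∷ [] ∷ [])

forcers-unique : ∀ {V} (T : Tournament V) {t} → Chain (_⟶[ T ]_) t → Unique (map proj₂ t)
forcers-unique T {[]} _ = []
forcers-unique T {_ ∷ _} (u⟶v ∷ forces , as ∷ afters) =
  Allₚ.map⁺ (All.map (λ { (_ , v⟶u′) refl → ⟶-asym T u⟶v v⟶u′ }) as) ∷
  forcers-unique T (forces , afters)

module _ {n} (T : Tournament (Fin n)) {S : Subset n} (S-forcing : IsForcingSet (orientation T) S) where

  record ForcingStep (C : Subset n) : Set where
    field
      forced forcer : Fin n
      forcer∈C : forcer ∈ₛ C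
      forced∉C : forced ∉ₛ C
      forces   : forcer ⟶[ T ] forced
      others∈C : ∀ w → forcer ⟶[ T ] w → w ≢ forced → w ∈ₛ C

  forcing-step : ∀ {C x} → S ⊆ₛ C → Colored (orientation T) S x → x ∉ₛ C → ForcingStep C
  forcing-step S⊆C (initial x∈S) x∉C with () ← x∉C (S⊆C x∈S)
  forcing-step {C} {x} S⊆C (force {u} u-coloured u⟶x others) x∉C with u ∈? C
  ... | no u∉C = forcing-step S⊆C u-coloured u∉C
  ... | yes u∈C with any? (λ w → (Tournament.arc T u w Bool.≟ true) ×-dec ¬? (w ≟ x) ×-dec ¬? (w ∈? C))
  ...   | yes (w , u⟶w , w≢x , w∉C) = forcing-step S⊆C (others w u⟶w w≢x) w∉C
  ...   | no none = record
    { forced = x ; forcer = u ; forcer∈C = u∈C ; forced∉C = x∉C ; forces = u⟶x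
    ; others∈C = λ w u⟶w w≢x → decidable-stable (w ∈? C) (λ w∉C → none (w , u⟶w , w≢x , w∉C)) }

  simulate : ∀ k {C done} → ∣ C ∣ + k ≡ n → S ⊆ₛ C → Chain (_⟶[ T ]_) done →
             (∀ w → w ∉ₛ C → All (After (_⟶[ T ]_) w) done) →
             Σ (List (Fin n × Fin n)) λ t → Chain (_⟶[ T ]_) t × length t ≡ k + length done
  simulate zero _ _ chain _ = _ , chain , refl
  simulate (suc k) {C} {done} size S⊆C (done-forces , done-afters) uncoloured-after with all? (_∈? C)
  ... | yes all∈C with () ← <⇒≱ (subst (∣ C ∣ <_) size (m<m+n ∣ C ∣ (s≤s z≤n)))
                                 (subst (_≤ ∣ C ∣) (∣⊤∣≡n n)
                                   (p⊆q⇒∣p∣≤∣q∣ {p = ⊤} (λ {x} _ → all∈C x)))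
  ... | no ¬all∈C with x , x∉C ← ¬∀⟶∃¬ n _ (_∈? C) ¬all∈C =
    let t , chain , len = simulate k size′ (y∈p⇒y∈p[x]≔inside forced ∘ S⊆C)
                            (forces ∷ done-forces , uncoloured-after forced forced∉C ∷ done-afters)
                            uncoloured-after′
    in t , chain , trans len (+-suc k (length done))
    where
    open ForcingStep (forcing-step S⊆C (S-forcing x) x∉C)
    C′ = C [ forced ]≔ inside

    size′ : ∣ C′ ∣ + k ≡ n
    size′ = trans (cong (_+ k) (∣p[x]≔inside∣≡suc∣p∣ forced∉C)) (trans (sym (+-suc ∣ C ∣ k)) size)

    uncoloured-after′ : ∀ w → w ∉ₛ C′ → All (After (_⟶[ T ]_) w) ((forced , forcer) ∷ done)
    uncoloured-after′ w w∉C′ = (w≢forced , w⟶forcer) ∷ uncoloured-after w w∉C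
      where
      w∉C : w ∉ₛ C
      w∉C = w∉C′ ∘ y∈p⇒y∈p[x]≔inside forced
      w≢forced : w ≢ forced
      w≢forced refl = w∉C′ ([]≔-updates C forced)
      w⟶forcer : w ⟶[ T ] forcer
      w⟶forcer with Tournament.total T w forcer (λ { refl → w∉C forcer∈C })
      ... | inj₁ w⟶forcer = w⟶forcer
      ... | inj₂ forcer⟶w with () ← w∉C (others∈C w forcer⟶w w≢forced)

  forcing-chain : Σ (List (Fin n × Fin n)) λ t → Chain (_⟶[ T ]_) t × length t ≡ n ∸ ∣ S ∣
  forcing-chain =
    let t , chain , len =
          simulate (n ∸ ∣ S ∣) (m+[n∸m]≡n (∣p∣≤n S)) (λ x∈S → x∈S) ([] , []) (λ _ _ → [])
    in t , chain , trans len (+-identityʳ _)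

forcing-sets-bounded : ∀ {n L} (T : Tournament (Fin n)) → RunsBoundedBy (_⟶[ T ]_) L →
                       AllForcingSetsSatisfy (orientation T) (λ s → n ∸ s ≤ L)
forcing-sets-bounded T bounded S S-forcing with _ , chain , len ← forcing-chain T S-forcing =
  subst (_≤ _) len (chain-length≤ bounded chain)

-- Common neighbourhoods

module _ {n} (T : Tournament (Fin n)) where

  outNbhd : Fin n → Subset n
  outNbhd x = tabulate (Tournament.arc T x)

  dominators : Fin n → Subset n
  dominators x = tabulate (λ w → does (w ≟ x) ∨ Tournament.arc T w x)

  ∈-outNbhd : ∀ {x y} → x ⟶[ T ] y → y ∈ₛ outNbhd x
  ∈-outNbhd {x} {y} x⟶y = lookup⇒[]= y _ (trans (lookup∘tabulate _ y) x⟶y)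

  ∈-dominators : ∀ {w x} → w ≽[ T ] x → w ∈ₛ dominators x
  ∈-dominators {w} {x} w≽x = lookup⇒[]= w _ (trans (lookup∘tabulate _ w) (dominates (w ≟ x) w≽x))
    where
    dominates : ∀ w≟x → w ≽[ T ] x → (does w≟x ∨ Tournament.arc T w x) ≡ true
    dominates (yes _)  _          = refl
    dominates (no w≢x) (inj₁ w≡x) with () ← w≢x w≡x
    dominates (no _)   (inj₂ w⟶x) = w⟶x

  commonOut-bounded? : ∀ k → Dec (∀ x y → x ≢ y → ∣ outNbhd x ∩ outNbhd y ∣ ≤ k)
  commonOut-bounded? k =
    all? λ x → all? λ y → ¬? (x ≟ y) →-dec (∣ outNbhd x ∩ outNbhd y ∣ ≤? k)

  commonDominators-bounded? : ∀ k → Dec (∀ x y → x ≢ y → ∣ dominators x ∩ dominators y ∣ ≤ k)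
  commonDominators-bounded? k =
    all? λ x → all? λ y → ¬? (x ≟ y) →-dec (∣ dominators x ∩ dominators y ∣ ≤? k)

  commonOut⇒strict-runs-bounded : ∀ {k} → (∀ x y → x ≢ y → ∣ outNbhd x ∩ outNbhd y ∣ ≤ k) →
                                  RunsBoundedBy (_⟶[ T ]_) (2 + k)
  commonOut⇒strict-runs-bounded common {t = []} _ = s≤s z≤n
  commonOut⇒strict-runs-bounded common {z} {(v , u) ∷ t} (chain , (z≢v , _) ∷ zs)
    with _ , (chain′ , vs) ← chain-head chain =
    s≤s (s≤s (≤-trans (subst (_≤ ∣ outNbhd z ∩ outNbhd v ∣) (length-map proj₂ t) counted)
                      (common z v z≢v)))
    where
    counted : length (map proj₂ t) ≤ ∣ outNbhd z ∩ outNbhd v ∣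
    counted = unique⇒length≤∣p∣ (forcers-unique T chain′)
      (Allₚ.map⁺ (All.zipWith (λ (z→ , v→) → x∈p∩q⁺ (∈-outNbhd (proj₂ z→) , ∈-outNbhd (proj₂ v→)))
                              (zs , vs)))

  -- Read the run earliest first.  If the two earliest forcers b₁, b₂ differ, every later forced
  -- vertex dominates both.  Otherwise the second step forced b₁ itself, so the third forcer
  -- differs from b₁ and every forced vertex after it dominates both.
  commonDominators⇒weak-runs-bounded : ∀ {k} →
    (∀ x y → x ≢ y → ∣ dominators x ∩ dominators y ∣ ≤ k) → RunsBoundedBy (_≽[ T ]_) (3 + k)
  commonDominators⇒weak-runs-bounded {k} common {z} {t} ((forces , afters) , zs) =
    subst (λ m → suc m ≤ 3 + k) (length-reverse t)
      (earliest-first (All-reverse⁺ forces) (AllPairs-reverse⁺ afters) (All-reverse⁺ zs))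
    where
    Earlier : Fin n × Fin n → Fin n × Fin n → Set
    Earlier q q′ = After (_≽[ T ]_) (proj₁ q′) q

    dominating-both : ∀ {b b′ r} → b ≢ b′ → AllPairs Earlier r → All (After (_≽[ T ]_) z) r →
      z ≽[ T ] b → z ≽[ T ] b′ → All (λ q → proj₁ q ≽[ T ] b) r → All (λ q → proj₁ q ≽[ T ] b′) r →
      suc (length r) ≤ k
    dominating-both {b} {b′} {r} b≢b′ earlier zs z≽b z≽b′ r≽b r≽b′ =
      ≤-trans (subst (_≤ ∣ dominators b ∩ dominators b′ ∣) (cong suc (length-map proj₁ r)) counted)
              (common b b′ b≢b′)
      where
      counted : length (z ∷ map proj₁ r) ≤ ∣ dominators b ∩ dominators b′ ∣
      counted = unique⇒length≤∣p∣
        (Allₚ.map⁺ (All.map proj₁ zs) ∷ AllPairsₚ.map⁺ (AllPairs.map (≢-sym ∘ proj₁) earlier))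
        (x∈p∩q⁺ (∈-dominators z≽b , ∈-dominators z≽b′) ∷
         Allₚ.map⁺ (All.zipWith (λ (≽b , ≽b′) → x∈p∩q⁺ (∈-dominators ≽b , ∈-dominators ≽b′))
                                (r≽b , r≽b′)))

    earliest-first : ∀ {r} → All (Forces (_≽[ T ]_)) r → AllPairs Earlier r → All (After (_≽[ T ]_) z) r →
                     suc (length r) ≤ 3 + k
    earliest-first {[]}              _ _ _ = s≤s z≤n
    earliest-first {_ ∷ []}          _ _ _ = s≤s (s≤s z≤n)
    earliest-first {_ ∷ _ ∷ []}      _ _ _ = s≤s (s≤s (s≤s z≤n))
    earliest-first {(a₁ , b₁) ∷ (a₂ , b₂) ∷ (a₃ , b₃) ∷ r}
      (_ ∷ b₂≽a₂ ∷ b₃≽a₃ ∷ _) ((e₁₂ ∷ e₁₃ ∷ e₁) ∷ (e₂₃ ∷ e₂) ∷ e₃ ∷ earlier) (z₁ ∷ z₂ ∷ z₃ ∷ zs)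
      with b₁ ≟ b₂
    ... | no b₁≢b₂ = s≤s (s≤s (m≤n⇒m≤1+n
            (dominating-both b₁≢b₂ (e₃ ∷ earlier) (z₃ ∷ zs) (proj₂ z₁) (proj₂ z₂)
               (proj₂ e₁₃ ∷ All.map proj₂ e₁) (proj₂ e₂₃ ∷ All.map proj₂ e₂))))
    ... | yes refl with b₁ ≟ b₃
    ...   | no b₁≢b₃ = s≤s (s≤s (s≤s
              (dominating-both b₁≢b₃ earlier zs (proj₂ z₁) (proj₂ z₃)
                 (All.map proj₂ e₁) (All.map proj₂ e₃))))
    ...   | yes refl with () ← proj₁ e₂₃ (trans (≽-antisym T (proj₂ e₁₃) b₃≽a₃)
                                                (sym (≽-antisym T (proj₂ e₁₂) b₂≽a₂)))

-- Lexicographic products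

module _ {A X : Set} (_≟ᴬ_ : DecidableEquality A) (Q : Tournament A) (B : Tournament X) where

  lexArc : A × X → A × X → Bool
  lexArc (a , x) (a′ , x′) with a ≟ᴬ a′
  ... | yes _ = Tournament.arc B x x′
  ... | no _  = Tournament.arc Q a a′

  lex : Tournament (A × X)
  lex = record { arc = lexArc ; irrefl = lexArc-irrefl ; total = lexArc-total ; antisym = lexArc-antisym }
    where
    lexArc-irrefl : ∀ u → lexArc u u ≡ false
    lexArc-irrefl (a , x) with a ≟ᴬ a
    ... | yes _  = Tournament.irrefl B x
    ... | no a≢a with () ← a≢a refl

    lexArc-total : ∀ u v → u ≢ v → lexArc u v ≡ true ⊎ lexArc v u ≡ true
    lexArc-total (a , x) (a′ , x′) u≢v with a ≟ᴬ a′ | a′ ≟ᴬ a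
    ... | yes refl | yes _    = Tournament.total B x x′ (u≢v ∘ cong (a ,_))
    ... | yes refl | no a≢a   with () ← a≢a refl
    ... | no a≢a′  | yes a′≡a with () ← a≢a′ (sym a′≡a)
    ... | no a≢a′  | no _     = Tournament.total Q a a′ a≢a′

    lexArc-antisym : ∀ u v → ¬ (lexArc u v ≡ true × lexArc v u ≡ true)
    lexArc-antisym (a , x) (a′ , x′) with a ≟ᴬ a′ | a′ ≟ᴬ a
    ... | yes refl | yes _    = Tournament.antisym B x x′
    ... | yes refl | no a≢a   with () ← a≢a refl
    ... | no a≢a′  | yes a′≡a with () ← a≢a′ (sym a′≡a)
    ... | no _     | no _     = Tournament.antisym Q a a′

  lex-block : ∀ {a x a′ x′} → (a , x) ⟶[ lex ] (a′ , x′) → a ≽[ Q ] a′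
  lex-block {a} {a′ = a′} u⟶v with a ≟ᴬ a′
  ... | yes a≡a′ = inj₁ a≡a′
  ... | no _     = inj₂ u⟶v

  lex-fibre : ∀ {a x x′} → (a , x) ⟶[ lex ] (a , x′) → x ⟶[ B ] x′
  lex-fibre {a} u⟶v with a ≟ᴬ a
  ... | yes _  = u⟶v
  ... | no a≢a with () ← a≢a refl

  block : (A × X) × (A × X) → A × A
  block = Product.map proj₁ proj₁

  fibre : (A × X) × (A × X) → X × X
  fibre = Product.map proj₂ proj₂

  InBlock : A → (A × X) × (A × X) → Set
  InBlock a q = block q ≡ (a , a)

  in-block : ∀ {a x q} → proj₁ (proj₁ q) ≡ a → Forces (_⟶[ lex ]_) q → After (_⟶[ lex ]_) (a , x) q →
             InBlock a q
  in-block {q = (_ , _) , (_ , _)} refl u⟶v (_ , z⟶u) = cong (_ ,_) (≽-antisym Q (lex-block u⟶v) (lex-block z⟶u))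

  fibre-after : ∀ {a x q} → InBlock a q → After (_⟶[ lex ]_) (a , x) q → After (_⟶[ B ]_) x (fibre q)
  fibre-after {a} refl (z≢v , z⟶u) = z≢v ∘ cong (a ,_) , lex-fibre z⟶u

  fibre-afters : ∀ {a x t} → All (InBlock a) t → All (After (_⟶[ lex ]_) (a , x)) t →
                 All (After (_⟶[ B ]_) x) (map fibre t)
  fibre-afters inBlock zs = Allₚ.map⁺ (All.zipWith (λ (q∈ , z≻q) → fibre-after q∈ z≻q) (inBlock , zs))

  fibre-run : ∀ {a x t} → Run (_⟶[ lex ]_) (a , x) t → All (InBlock a) t → Run (_⟶[ B ]_) x (map fibre t)
  fibre-run {t = []} _ [] = ([] , []) , []
  fibre-run {t = ((_ , x₁) , _) ∷ _} ((u⟶v ∷ forces , as ∷ afters) , z≻q ∷ zs) (refl ∷ inBlock) =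
    let (forces′ , afters′) , _ = fibre-run {x = x₁} ((forces , afters) , as) inBlock in
    (lex-fibre u⟶v ∷ forces′ , fibre-afters inBlock as ∷ afters′) ,
    fibre-after refl z≻q ∷ fibre-afters inBlock zs

  module _ {L : ℕ} (B-bounded : RunsBoundedBy (_⟶[ B ]_) L) where

    -- The steps of t fall into groups by the block of their forced vertex; s lists, latest
    -- first, the blocks of the last step of each group other than that of z.
    BlockRun : A × X → List ((A × X) × (A × X)) → Set
    BlockRun z t = Σ (List (A × A)) λ s →
      Run (_≽[ Q ]_) (proj₁ z) s × s ⊆ map block t × suc (length t) ≤ suc (length s) * L

    block-run : ∀ {z t} → Run (_⟶[ lex ]_) z t → Acc _<_ (length t) → BlockRun z t
    block-run {a , x} {t} (chain@(forces , _) , zs) (acc smaller) =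
      groups (length-filter-∁ InBlock? t) (chain-filter (∁? InBlock?) chain)
        (Allₚ.filter⁺ (∁? InBlock?) zs) (Allₚ.all-filter (∁? InBlock?) t) (filter-⊆ (∁? InBlock?) t)
      where
      InBlock? : Decidable (λ q → proj₁ (proj₁ q) ≡ a)
      InBlock? q = proj₁ (proj₁ q) ≟ᴬ a

      Xs = filter InBlock? t

      Xs-bounded : suc (length Xs) ≤ L
      Xs-bounded = subst (λ k → suc k ≤ L) (length-map fibre Xs) (B-bounded (fibre-run runXs inBlock))
        where
        runXs = chain-filter InBlock? chain , Allₚ.filter⁺ InBlock? zs
        inBlock = All.zipWith (λ (q∈a , u⟶v , z≻q) → in-block q∈a u⟶v z≻q)
                    (Allₚ.all-filter InBlock? t ,
                     All.zip (Allₚ.filter⁺ InBlock? forces , Allₚ.filter⁺ InBlock? zs))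

      shorter : ∀ {q Ys} → length t ≡ length Xs + length (q ∷ Ys) → length Ys < length t
      shorter {Ys = Ys} len = subst (length Ys <_) (sym len) (m≤n+m (suc (length Ys)) (length Xs))

      groups : ∀ {Ys} → length t ≡ length Xs + length Ys → Chain (_⟶[ lex ]_) Ys →
               All (After (_⟶[ lex ]_) (a , x)) Ys → All (∁ (λ q → proj₁ (proj₁ q) ≡ a)) Ys → Ys ⊆ t →
               BlockRun (a , x) t
      groups {[]} len _ _ _ _ =
        [] , (([] , []) , []) , (λ ()) , subst (λ k → suc k ≤ 1 * L) (sym len) (+-monoˡ-≤ 0 Xs-bounded)
      groups {(v , u) ∷ Ys} len chainYs (z≻vu ∷ zYs) (v∉a ∷ v∉as) Ys⊆t
        with u⟶v , runYs ← chain-head chainYs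
        with s , ((forces′ , afters′) , v≻s) , s⊆ , len′ ← block-run runYs (smaller (shorter {v , u} {Ys} len)) =
        block (v , u) ∷ s ,
        ((lex-block u⟶v ∷ forces′ , v≻s ∷ afters′) , (≢-sym v∉a , lex-block (proj₂ z≻vu)) ∷ a≻s) ,
        ∈-∷⁺ʳ (∈-map⁺ block (Ys⊆t (Any.here refl))) (⊆-trans s⊆ (⊆-map⁺ block (Ys⊆t ∘ Any.there))) ,
        subst (λ k → suc k ≤ suc (suc (length s)) * L) (sym len) (+-mono-≤ Xs-bounded len′)
        where
        a≻s : All (After (_≽[ Q ]_) a) s
        a≻s = Allₚ.anti-mono s⊆ (Allₚ.map⁺
                (All.zipWith (λ (v∉a , _ , z⟶u) → ≢-sym v∉a , lex-block z⟶u) (v∉as , zYs)))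

  lex-runs-bounded : ∀ {R L} → RunsBoundedBy (_≽[ Q ]_) R → RunsBoundedBy (_⟶[ B ]_) L →
                     RunsBoundedBy (_⟶[ lex ]_) (R * L)
  lex-runs-bounded {L = L} Q-bounded B-bounded run
    with _ , runQ , _ , len ← block-run B-bounded run (<-wellFounded _) =
    ≤-trans len (*-monoˡ-≤ L (Q-bounded runQ))

-- Paley tournaments and products of them

-- The Paley tournament: x ⟶ y iff y - x is a nonzero square modulo p (p is added before
-- subtracting, as ∸ truncates).
paleyArc : ∀ p .{{_ : NonZero p}} → Fin p → Fin p → Bool
paleyArc p x y = any (λ r → (suc r * suc r) % p ≡ᵇ (toℕ y + p ∸ toℕ x) % p) (upTo (p ∸ 1))

paley11 : Tournament (Fin 11)
paley11 = decidedTournament (paleyArc 11)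

paley19 : Tournament (Fin 19)
paley19 = decidedTournament (paleyArc 19)

paley11-strict : RunsBoundedBy (_⟶[ paley11 ]_) 4
paley11-strict = commonOut⇒strict-runs-bounded paley11 (toWitness {a? = commonOut-bounded? paley11 2} _)

paley11-weak : RunsBoundedBy (_≽[ paley11 ]_) 6
paley11-weak = commonDominators⇒weak-runs-bounded paley11 (toWitness {a? = commonDominators-bounded? paley11 3} _)

paley19-strict : RunsBoundedBy (_⟶[ paley19 ]_) 6
paley19-strict = commonOut⇒strict-runs-bounded paley19 (toWitness {a? = commonOut-bounded? paley19 4} _)

paley19-weak : RunsBoundedBy (_≽[ paley19 ]_) 8
paley19-weak = commonDominators⇒weak-runs-bounded paley19 (toWitness {a? = commonDominators-bounded? paley19 5} _)

record WeaklyBounded : Set where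
  field
    size bound   : ℕ
    tournament   : Tournament (Fin size)
    runs-bounded : RunsBoundedBy (_≽[ tournament ]_) bound

record StrictlyBounded : Set where
  field
    size bound   : ℕ
    tournament   : Tournament (Fin size)
    runs-bounded : RunsBoundedBy (_⟶[ tournament ]_) bound

open WeaklyBounded using (size; bound)
open StrictlyBounded using (size; bound)

infixr 5 _⊗_

_⊗_ : WeaklyBounded → StrictlyBounded → StrictlyBounded
Q ⊗ B = record
  { size         = size Q * size B
  ; bound        = bound Q * bound B
  ; tournament   = pullback (Inverse.to *↔×) ↔-injective product
  ; runs-bounded = runs-bounded-on ↔-injective
      (lex-runs-bounded _≟_ (WeaklyBounded.tournament Q) (StrictlyBounded.tournament B)
         (WeaklyBounded.runs-bounded Q) (StrictlyBounded.runs-bounded B))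
  }
  where
  product = lex _≟_ (WeaklyBounded.tournament Q) (StrictlyBounded.tournament B)
  ↔-injective = Injection.injective (↔⇒↣ *↔×)

tower : List WeaklyBounded → StrictlyBounded → StrictlyBounded
tower layers base = foldr _⊗_ base layers

copies : ℕ → WeaklyBounded
copies m = record { size = m ; bound = m ; tournament = transitive m ; runs-bounded = fin-runs-bounded }

T₂ˢ : StrictlyBounded
T₂ˢ = record
  { size = 2 ; bound = 1 ; tournament = transitive 2 ; runs-bounded = fin2-strict-runs-bounded (transitive 2) }

P₁₁ʷ P₁₉ʷ : WeaklyBounded
P₁₁ʷ = record { size = 11 ; bound = 6 ; tournament = paley11 ; runs-bounded = paley11-weak }
P₁₉ʷ = record { size = 19 ; bound = 8 ; tournament = paley19 ; runs-bounded = paley19-weak }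

P₁₁ˢ P₁₉ˢ : StrictlyBounded
P₁₁ˢ = record { size = 11 ; bound = 4 ; tournament = paley11 ; runs-bounded = paley11-strict }
P₁₉ˢ = record { size = 19 ; bound = 6 ; tournament = paley19 ; runs-bounded = paley19-strict }

-- Numerical bounds

^-cancelʳ-≤ : ∀ a .{{_ : NonZero a}} {x y} → x ^ a ≤ y ^ a → x ≤ y
^-cancelʳ-≤ a {x} {y} xᵃ≤yᵃ with x ≤? y
... | yes x≤y = x≤y
... | no x≰y  = contradiction xᵃ≤yᵃ (<⇒≱ (^-monoˡ-< a (≰⇒> x≰y)))

-- x ^ a ≤ 2 ^ c says log₂ x ≤ c / a, so c * L ≤ 2 * a * n gives L * log₂ n ≤ 2 * n.
n^L≤2^[2n] : ∀ {n x a c L} .{{_ : NonZero a}} → n ≤ x → x ^ a ≤ 2 ^ c → c * L ≤ 2 * a * n →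
             n ^ L ≤ 2 ^ (2 * n)
n^L≤2^[2n] {n} {x} {a} {c} {L} n≤x xᵃ≤2ᶜ cL≤2an = ^-cancelʳ-≤ a (begin
  (n ^ L) ^ a       ≡⟨ ^-*-assoc n L a ⟩
  n ^ (L * a)       ≡⟨ cong (n ^_) (*-comm L a) ⟩
  n ^ (a * L)       ≡⟨ ^-*-assoc n a L ⟨
  (n ^ a) ^ L       ≤⟨ ^-monoˡ-≤ L (^-monoˡ-≤ a n≤x) ⟩
  (x ^ a) ^ L       ≤⟨ ^-monoˡ-≤ L xᵃ≤2ᶜ ⟩
  (2 ^ c) ^ L       ≡⟨ ^-*-assoc 2 c L ⟩
  2 ^ (c * L)       ≤⟨ ^-monoʳ-≤ 2 cL≤2an ⟩
  2 ^ (2 * a * n)   ≡⟨ cong (2 ^_) (xy∙z≈xz∙y 2 a n) ⟩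
  2 ^ (2 * n * a)   ≡⟨ ^-*-assoc 2 (2 * n) a ⟨
  (2 ^ (2 * n)) ^ a ∎)
  where open ≤-Reasoning

Witness : ℕ → Set
Witness n = Σ StrictlyBounded λ D → n ≤ size D × n ^ bound D ≤ 2 ^ (2 * n)

witness⇒orientation : ∀ {n} .{{_ : NonZero n}} → Witness n →
  Σ (OrientationK n) λ D → AllForcingSetsSatisfy D (λ s → n ^ (n ∸ s) ≤ 2 ^ (2 * n))
witness⇒orientation {n} (D , n≤N , n^L≤4^n) =
  orientation T , λ S S-forcing → ≤-trans (^-monoʳ-≤ n (forcing-sets-bounded T bounded S S-forcing)) n^L≤4^n
  where
  inject-injective : Injective _≡_ _≡_ (λ i → inject≤ i n≤N)
  inject-injective = inject≤-injective n≤N n≤N _ _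
  T = pullback (λ i → inject≤ i n≤N) inject-injective (StrictlyBounded.tournament D)
  bounded = runs-bounded-on inject-injective (StrictlyBounded.runs-bounded D)

record Certificate (lo hi : ℕ) : Set where
  field
    design     : StrictlyBounded
    a c        : ℕ
    a-nonZero  : NonZero a
    covers     : hi ≤ size design
    log₂-bound : hi ^ a ≤ 2 ^ c
    rate       : c * bound design ≤ 2 * a * lo

certify : ∀ {lo} hi (D : StrictlyBounded) a c {{_ : NonZero a}} →
  {True (hi ≤? size D)} → {True (hi ^ a ≤? 2 ^ c)} → {True (c * bound D ≤? 2 * a * lo)} →
  Certificate lo hi
certify hi D a c {{a≢0}} {covers} {log₂-bound} {rate} = record
  { design = D ; a = a ; c = c ; a-nonZero = a≢0
  ; covers = toWitness covers ; log₂-bound = toWitness log₂-bound ; rate = toWitness rate }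

certificate-witness : ∀ {lo hi n} → Certificate lo hi → lo ≤ n → n ≤ hi → Witness n
certificate-witness cert lo≤n n≤hi =
  design , ≤-trans n≤hi covers ,
  n^L≤2^[2n] {c = c} {L = bound design} {{a-nonZero}} n≤hi log₂-bound
    (≤-trans rate (*-monoʳ-≤ (2 * a) lo≤n))
  where open Certificate cert

infixr 5 _∷_

data Covered (top : ℕ) : ℕ → Set where
  done : Covered top top
  _∷_  : ∀ {lo hi} → Certificate lo hi → Covered top (suc hi) → Covered top lo

covered-witness : ∀ {top lo n} → Covered top lo → lo ≤ n → n < top → Witness n
covered-witness done lo≤n n<top = contradiction lo≤n (<⇒≱ n<top)
covered-witness {n = n} (_∷_ {hi = hi} cert rest) lo≤n n<top with n ≤? hi
... | yes n≤hi = certificate-witness cert lo≤n n≤hi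
... | no n≰hi  = covered-witness rest (≰⇒> n≰hi) n<top

design : ℕ → List WeaklyBounded → StrictlyBounded → StrictlyBounded
design m layers base = copies m ⊗ tower layers base

small-cases : Covered 13718 2
small-cases =
    certify 2     (design 1 []                        P₁₁ˢ)  1  1
  ∷ certify 4     (design 2 []                        T₂ˢ)   1  2
  ∷ certify 6     (design 3 []                        T₂ˢ)   1  3
  ∷ certify 11    (design 1 []                        P₁₁ˢ)  2  7
  ∷ certify 16    (design 1 []                        P₁₉ˢ)  1  4
  ∷ certify 22    (design 1 (P₁₁ʷ ∷ [])               T₂ˢ)   1  5
  ∷ certify 38    (design 1 (P₁₉ʷ ∷ [])               T₂ˢ)   2  11
  ∷ certify 44    (design 2 (P₁₁ʷ ∷ [])               T₂ˢ)   1  6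
  ∷ certify 49    (design 2 (P₁₉ʷ ∷ [])               T₂ˢ)   8  45
  ∷ certify 76    (design 2 (P₁₉ʷ ∷ [])               T₂ˢ)   4  25
  ∷ certify 85    (design 1 (P₁₁ʷ ∷ [])               P₁₁ˢ)  12 77
  ∷ certify 121   (design 1 (P₁₁ʷ ∷ [])               P₁₁ˢ)  1  7
  ∷ certify 197   (design 1 (P₁₉ʷ ∷ [])               P₁₁ˢ)  8  61
  ∷ certify 304   (design 1 (P₁₉ʷ ∷ [])               P₁₉ˢ)  4  33
  ∷ certify 722   (design 1 (P₁₉ʷ ∷ P₁₉ʷ ∷ [])        T₂ˢ)   2  19
  ∷ certify 1444  (design 2 (P₁₉ʷ ∷ P₁₉ʷ ∷ [])        T₂ˢ)   1  11
  ∷ certify 2662  (design 1 (P₁₁ʷ ∷ P₁₁ʷ ∷ P₁₁ʷ ∷ []) T₂ˢ)   1  12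
  ∷ certify 7942  (design 1 (P₁₁ʷ ∷ P₁₉ʷ ∷ P₁₉ʷ ∷ []) T₂ˢ)   1  13
  ∷ certify 13717 (design 2 (P₁₉ʷ ∷ P₁₉ʷ ∷ [])        P₁₉ˢ)  1  14
  ∷ done

uniform : ℕ → StrictlyBounded
uniform j = tower (replicate j P₁₉ʷ) T₂ˢ

exponent : ℕ → ℕ
exponent zero    = 6
exponent (suc j) = 5 + exponent j

exponent≥5 : ∀ j → 5 ≤ exponent j
exponent≥5 zero    = ≤ᵇ⇒≤ 5 6 _
exponent≥5 (suc j) = ≤-trans (exponent≥5 j) (m≤n+m _ 5)

uniform-size>0 : ∀ j → 0 < size (uniform j)
uniform-size>0 zero    = s≤s z≤n
uniform-size>0 (suc j) = ≤-trans (uniform-size>0 j) (m≤n*m _ 19)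

uniform-increasing : ∀ j → size (uniform j) < size (uniform (suc j))
uniform-increasing j = m<m+n (size (uniform j)) (≤-trans (uniform-size>0 j) (m≤n*m _ 18))

uniform-size≤2^ : ∀ j → 19 * size (uniform j) ≤ 2 ^ exponent j
uniform-size≤2^ zero    = ≤ᵇ⇒≤ 38 64 _
uniform-size≤2^ (suc j) = begin
  19 * (19 * size (uniform j)) ≤⟨ *-monoˡ-≤ (19 * size (uniform j)) (≤ᵇ⇒≤ 19 32 _) ⟩
  32 * (19 * size (uniform j)) ≤⟨ *-monoʳ-≤ 32 (uniform-size≤2^ j) ⟩
  32 * 2 ^ exponent j          ≡⟨ ^-distribˡ-+-* 2 5 (exponent j) ⟨
  2 ^ (5 + exponent j)         ∎
  where open ≤-Reasoning

uniform-rate : ∀ i → exponent (3 + i) * bound (uniform (3 + i)) ≤ size (uniform (3 + i))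
uniform-rate zero    = ≤ᵇ⇒≤ (21 * 512) 13718 _
uniform-rate (suc i) = begin
  (5 + K) * (8 * B)           ≤⟨ *-monoˡ-≤ (8 * B) (+-monoˡ-≤ K (exponent≥5 (3 + i))) ⟩
  (K + K) * (8 * B)           ≡⟨ regroup K B ⟩
  16 * (K * B)                ≤⟨ *-mono-≤ (≤ᵇ⇒≤ 16 19 _) (uniform-rate i) ⟩
  19 * size (uniform (3 + i)) ∎
  where
  open ≤-Reasoning
  K = exponent (3 + i)
  B = bound (uniform (3 + i))
  regroup : ∀ K B → (K + K) * (8 * B) ≡ 16 * (K * B)
  regroup = solve-∀

bracket : (f : ℕ → ℕ) → (∀ j → f j < f (suc j)) →
          ∀ {k n} → f k ≤ n → Σ ℕ λ i → f (k + i) ≤ n × n < f (suc (k + i))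
bracket f increasing {k} {n} fk≤n =
  search (suc n) 0 (subst (λ j → f j ≤ n) (sym (+-identityʳ k)) fk≤n) (s≤s (≤-reflexive (sym (+-identityʳ n))))
  where
  unbounded : ∀ i → i ≤ f (k + i)
  unbounded zero    = z≤n
  unbounded (suc i) = subst (λ j → suc i ≤ f j) (sym (+-suc k i)) (≤-trans (s≤s (unbounded i)) (increasing (k + i)))

  search : ∀ fuel i → f (k + i) ≤ n → n < fuel + i → Σ ℕ λ i → f (k + i) ≤ n × n < f (suc (k + i))
  search fuel i fki≤n n<fuel+i with n <? f (suc (k + i))
  ... | yes n<next = i , fki≤n , n<next
  search zero i fki≤n n<i | no _ = contradiction (≤-trans (unbounded i) fki≤n) (<⇒≱ n<i)
  search (suc fuel) i fki≤n n<fuel+i | no n≮next =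
    search fuel (suc i) (subst (λ j → f j ≤ n) (sym (+-suc k i)) (≮⇒≥ n≮next))
      (subst (n <_) (sym (+-suc fuel i)) n<fuel+i)

round-up : ∀ n N .{{_ : NonZero N}} → n < suc (n / N) * N × suc (n / N) * N ≤ n + N
round-up n N =
  subst (_< N + n / N * N) (sym (m≡m%n+[m/n]*n n N)) (+-monoˡ-< (n / N * N) (m%n<n n N)) ,
  subst (N + n / N * N ≤_) (+-comm N n) (+-monoʳ-≤ N (m/n*n≤m n N))

between-uniform-witness : ∀ {n} i → size (uniform (3 + i)) ≤ n → n < size (uniform (4 + i)) → Witness n
between-uniform-witness {n} i N≤n n<19N =
  copies m ⊗ uniform j , <⇒≤ (proj₁ (round-up n N)) ,
  n^L≤2^[2n] {a = 1} {c = exponent j} {L = m * bound (uniform j)}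
    (≤-trans (<⇒≤ n<19N) (uniform-size≤2^ j)) (≤-reflexive (*-identityʳ _)) rate
  where
  j = 3 + i
  N = size (uniform j)
  instance
    N≢0 : NonZero N
    N≢0 = >-nonZero (uniform-size>0 j)
  m = suc (n / N)
  rate : exponent j * (m * bound (uniform j)) ≤ 2 * 1 * n
  rate = begin
    exponent j * (m * bound (uniform j)) ≡⟨ x∙yz≈y∙xz (exponent j) m (bound (uniform j)) ⟩
    m * (exponent j * bound (uniform j)) ≤⟨ *-monoʳ-≤ m (uniform-rate i) ⟩
    m * N                                ≤⟨ proj₂ (round-up n N) ⟩
    n + N                                ≤⟨ +-monoʳ-≤ n N≤n ⟩
    n + n                                ≡⟨ cong (n +_) (+-identityʳ n) ⟨
    2 * 1 * n                            ∎
    where open ≤-Reasoning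

uniform-witness : ∀ {n} → size (uniform 3) ≤ n → Witness n
uniform-witness N₃≤n =
  let i , N≤n , n<19N = bracket (size ∘ uniform) uniform-increasing {k = 3} N₃≤n
  in between-uniform-witness i N≤n n<19N

theorem8 : ∀ (n : ℕ) → 2 ≤ n →
    Σ (OrientationK n) λ D →
      AllForcingSetsSatisfy D (λ s → n ^ (n ∸ s) ≤ 2 ^ (2 * n))
theorem8 n@(suc _) 2≤n with n <? size (uniform 3)
... | yes n<N₃ = witness⇒orientation (covered-witness small-cases 2≤n n<N₃)
... | no n≮N₃  = witness⇒orientation (uniform-witness (≮⇒≥ n≮N₃))
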